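{- Let $X_1$ and $X_2$ be disjoint finite sets, let $M$ be an $\mathrm{iso}(X_1,X_1\cup X_2)$-fragile matroid, and let $M'$ be obtained from $M$ by adding a new element $d$ freely into the flat spanned by $X_2$. Then $M'\setminus X_2$ is $\mathrm{iso}(X_1,X_1\cup \{d\})$-fragile.
   Context: For a flat $F$ of a matroid $M$, a matroid $M'$ is obtained by adding an element $e$ freely to $F$ in $M$ if $M'$ is a single-element extension of $M$ by a new element $e$ such that $F$ spans $e$ in $M'$ and every flat of $M'\setminus e=M$ that spans $e$ contains $F$. For a finite set $E$ and $B\subseteq E$, $\mathrm{iso}(B,E)$ is the matroid on $E$ in which every element of $B$ is a coloop and every element of $E-B$ is a loop. A matroid $M$ is $N$-fragile if $N$ itself (on ground set $E(N)\subseteq E(M)$) equals $M/C\setminus D$ for some partition $(C,D)$ of $E(M)-E(N)$, but there is no $e\in E(M)$ such that $N$ is a minor of both $M\setminus e$ and $M/e$. -}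

module Defs where

open import Data.Nat using (ℕ; zero; suc; _+_; _<_; _≤_; _≡ᵇ_)
open import Data.Bool using (Bool; true; false; _∧_; _∨_; not; if_then_else_)
open import Data.Product using (Σ; Σ-syntax; _×_; _,_)
open import Data.Sum using (_⊎_)
open import Relation.Nullary using (¬_)
open import Relation.Binary.PropositionalEquality using (_≡_)
open import Function.Bundles using (_⇔_)

-- Finite subsets of the label set ℕ, as decidable predicates

Subset : Set
Subset = ℕ → Bool

infix 4 _∈_ _∉_ _⊆_

_∈_ : ℕ → Subset → Set
x ∈ X = X x ≡ true

_∉_ : ℕ → Subset → Set
x ∉ X = ¬ (x ∈ X)

_⊆_ : Subset → Subset → Set
X ⊆ Y = ∀ x → x ∈ X → x ∈ Y

∅ : Subset
∅ _ = false

⁅_⁆ : ℕ → Subset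
⁅ e ⁆ x = e ≡ᵇ x

infixl 6 _∪_ _─_

_∪_ : Subset → Subset → Subset
(X ∪ Y) x = X x ∨ Y x

_─_ : Subset → Subset → Subset
(X ─ Y) x = X x ∧ not (Y x)

Finite : Subset → Set
Finite X = Σ ℕ λ n → ∀ x → x ∈ X → x < n

Disjoint : Subset → Subset → Set
Disjoint X Y = ∀ x → x ∈ X → x ∉ Y

-- number of elements of X below n (equals |X| whenever X ⊆ {0,…,n-1})
count : ℕ → Subset → ℕ
count zero    X = 0
count (suc n) X = (if X n then 1 else 0) + count n X

record PreMatroid : Set₁ where
  field
    E   : Subset
    Ind : Subset → Set
open PreMatroid public

record Matroid : Set₁ where
  field
    pre       : PreMatroid
    bound     : ℕ
    E-bounded : ∀ x → x ∈ E pre → x < bound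
    Ind-⊆E    : ∀ I → Ind pre I → I ⊆ E pre
    Ind-∅     : Ind pre ∅
    Ind-hered : ∀ I J → I ⊆ J → Ind pre J → Ind pre I
    Ind-aug   : ∀ I J → Ind pre I → Ind pre J → count bound I < count bound J →
                Σ ℕ λ e → e ∈ J × e ∉ I × Ind pre (I ∪ ⁅ e ⁆)
open Matroid public

IsBasisOf : PreMatroid → Subset → Subset → Set
IsBasisOf M B X =
  B ⊆ X × Ind M B × (∀ J → B ⊆ J → J ⊆ X → Ind M J → J ⊆ B)

infixl 5 _＼_ _／_
_＼_ : PreMatroid → Subset → PreMatroid
M ＼ X = record { E = E M ─ X ; Ind = λ I → I ⊆ (E M ─ X) × Ind M I }

_／_ : PreMatroid → Subset → PreMatroid
M ／ X = record { E = E M ─ X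
                ; Ind = λ I → I ⊆ (E M ─ X) × Σ Subset (λ B → IsBasisOf M B X × Ind M (I ∪ B)) }

_≅_ : PreMatroid → PreMatroid → Set
N ≅ M = (∀ x → (x ∈ E N) ⇔ (x ∈ E M)) × (∀ I → Ind N I ⇔ Ind M I)

IsPartition : Subset → Subset → Subset → Set
IsPartition C D S = ∀ x → ((x ∈ C ⊎ x ∈ D) ⇔ x ∈ S) × ¬ (x ∈ C × x ∈ D)

IsMinor : PreMatroid → PreMatroid → Set
IsMinor N M = E N ⊆ E M ×
  Σ Subset λ C → Σ Subset λ D → IsPartition C D (E M ─ E N) × (N ≅ ((M ／ C) ＼ D))

Fragile : PreMatroid → PreMatroid → Set
Fragile N M = IsMinor N M ×
  ¬ (Σ ℕ λ e → e ∈ E M × IsMinor N (M ＼ ⁅ e ⁆) × IsMinor N (M ／ ⁅ e ⁆))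

-- iso(B, S): elements of B coloops, elements of S - B loops
iso : Subset → Subset → PreMatroid
iso B S = record { E = S ; Ind = λ I → I ⊆ B }

IsRank : Matroid → Subset → ℕ → Set
IsRank M X k =
  (Σ Subset λ I → I ⊆ X × Ind (pre M) I × count (bound M) I ≡ k) ×
  (∀ J → J ⊆ X → Ind (pre M) J → count (bound M) J ≤ k)

Spans : Matroid → Subset → ℕ → Set
Spans M X e = e ∈ E (pre M) × Σ ℕ λ k → IsRank M X k × IsRank M (X ∪ ⁅ e ⁆) k

IsClosure : Matroid → Subset → Subset → Set
IsClosure M X F = ∀ x → (x ∈ F) ⇔ Spans M X x

IsFlat : Matroid → Subset → Set
IsFlat M F = F ⊆ E (pre M) × (∀ e → Spans M F e → e ∈ F)

AddedFreely : Matroid → Matroid → Subset → ℕ → Set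
AddedFreely M M' F e =
  e ∉ E (pre M) ×
  (∀ x → (x ∈ E (pre M')) ⇔ (x ∈ E (pre M) ⊎ x ≡ e)) ×
  (pre M ≅ (pre M' ＼ ⁅ e ⁆)) ×
  Spans M' F e ×
  (∀ F' → IsFlat M F' → Spans M' F' e → F ⊆ F')

module Submission where

-- A minor iso(X, X ∪ Y) = A / C \ D is handled through an explicit description
-- (IsoMinorVia): (C , D) partitions E(A) - (X ∪ Y), subsets of X stay independent after
-- contracting C, and every basis of C spans Y.  Away from d and X₂, M, M' and P' have the
-- same independent sets, so such descriptions move between them; only the clause about Y
-- needs thought, and it is settled by the key equivalence, for B independent in M:
--     B spans d in M'   ⟺   B spans X₂ in M.
-- "⟸" holds because d ∈ cl_{M'}(F); "⟹" because cl_M(B) is a flat spanning d in M', which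
-- by freeness contains F ⊇ X₂.  Hence a description of N = iso(X₁, X₁ ∪ X₂) in M gives one
-- of N' = iso(X₁, X₁ ∪ {d}) in P' with the same (C , D), and descriptions of N' in P' \ e and
-- P' / e give descriptions of N in M \ e and M / e: an element showing that P' is not
-- N'-fragile would show that M is not N-fragile.
--
-- Independence is not decidable, so bases and closures are only chosen under double
-- negation; every use of them has a negative (⊥-valued) goal.

open import Defs
open import Data.Nat using (ℕ; zero; suc; _+_; _∸_; _<_; _≤_; _≡ᵇ_)
open import Data.Nat.Properties
  using (≡ᵇ⇒≡; ≡⇒≡ᵇ; ≤-refl; ≤-trans; ≤-reflexive; ≮⇒≥; n≤1+n; 1+n≰n; m<n⇒m<1+n; m<1+n⇒m<n∨m≡n;
         <⇒≢; m+[n∸m]≡n; +-identityʳ; +-suc; +-monoʳ-≤)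
open import Data.Bool using (true; false; _∨_; if_then_else_)
open import Data.Bool.Properties using (T-≡; ¬-not; ∨-identityʳ) renaming (_≟_ to _≟ᵇ_)
open import Data.Product using (Σ; _×_; _,_; proj₁; proj₂)
open import Data.Sum using (_⊎_; inj₁; inj₂; [_,_]′)
open import Data.Empty using (⊥; ⊥-elim)
open import Relation.Nullary using (¬_; Dec; yes; no)
open import Relation.Nullary.Decidable using (decidable-stable; ¬¬-excluded-middle)
open import Relation.Nullary.Negation using (¬¬-Monad)
open import Relation.Binary.PropositionalEquality using (_≡_; _≢_; refl; sym; trans; cong; subst)
open import Effect.Monad using (RawMonad)
open import Level using (0ℓ)
open import Function using (_∘_)
open import Function.Bundles using (_⇔_; mk⇔; Equivalence)

open Equivalence using (to; from)
open RawMonad (¬¬-Monad {a = 0ℓ}) using (pure; _>>=_)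

_∈?_ : ∀ x X → Dec (x ∈ X)
x ∈? X = X x ≟ᵇ true

∈-stable : ∀ {x} X → ¬ ¬ (x ∈ X) → x ∈ X
∈-stable {x} X = decidable-stable (x ∈? X)

∉⇒false : ∀ {x} X → x ∉ X → X x ≡ false
∉⇒false X = ¬-not

∈∪ˡ : ∀ X Y {x} → x ∈ X → x ∈ X ∪ Y
∈∪ˡ X Y {x} p rewrite p = refl

∈∪ʳ : ∀ X Y {x} → x ∈ Y → x ∈ X ∪ Y
∈∪ʳ X Y {x} p with X x
... | true  = refl
... | false = p

∈∪⁻ : ∀ X Y {x} → x ∈ X ∪ Y → x ∈ X ⊎ x ∈ Y
∈∪⁻ X Y {x} p with X x
... | true  = inj₁ refl
... | false = inj₂ p

∉∪ : ∀ X Y {x} → x ∉ X → x ∉ Y → x ∉ X ∪ Y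
∉∪ X Y x∉X x∉Y p = [ x∉X , x∉Y ]′ (∈∪⁻ X Y p)

∈─ : ∀ X Y {x} → x ∈ X → x ∉ Y → x ∈ X ─ Y
∈─ X Y {x} p q rewrite p | ∉⇒false Y q = refl

∈─⁻ˡ : ∀ X Y {x} → x ∈ X ─ Y → x ∈ X
∈─⁻ˡ X Y {x} p with X x
... | true  = refl
... | false = p

∈─⁻ʳ : ∀ X Y {x} → x ∈ X ─ Y → x ∉ Y
∈─⁻ʳ X Y {x} p q rewrite q with X x | p
... | true  | ()
... | false | ()

∈⁅⁆⇔ : ∀ e x → x ∈ ⁅ e ⁆ ⇔ e ≡ x
∈⁅⁆⇔ e x = mk⇔ (λ p → ≡ᵇ⇒≡ e x (from T-≡ p)) (λ e≡x → to T-≡ (≡⇒≡ᵇ e x e≡x))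

∈⁅⁆ : ∀ x → x ∈ ⁅ x ⁆
∈⁅⁆ x = from (∈⁅⁆⇔ x x) refl

∉⁅⁆ : ∀ {e x} → e ≢ x → x ∉ ⁅ e ⁆
∉⁅⁆ {e} {x} e≢x p = e≢x (to (∈⁅⁆⇔ e x) p)

⊆-refl : ∀ {X} → X ⊆ X
⊆-refl x p = p

⊆-trans : ∀ {X Y Z} → X ⊆ Y → Y ⊆ Z → X ⊆ Z
⊆-trans X⊆Y Y⊆Z x p = Y⊆Z x (X⊆Y x p)

⊆-∪ˡ : ∀ {X Y} → X ⊆ X ∪ Y
⊆-∪ˡ {X} {Y} x = ∈∪ˡ X Y

⊆-∪ʳ : ∀ {X Y} → Y ⊆ X ∪ Y
⊆-∪ʳ {X} {Y} x = ∈∪ʳ X Y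

∪-⊆ : ∀ {X Y Z} → X ⊆ Z → Y ⊆ Z → X ∪ Y ⊆ Z
∪-⊆ {X} {Y} X⊆Z Y⊆Z x p = [ X⊆Z x , Y⊆Z x ]′ (∈∪⁻ X Y p)

∪-mono : ∀ {X Y X' Y'} → X ⊆ X' → Y ⊆ Y' → X ∪ Y ⊆ X' ∪ Y'
∪-mono X⊆X' Y⊆Y' = ∪-⊆ (⊆-trans X⊆X' ⊆-∪ˡ) (⊆-trans Y⊆Y' ⊆-∪ʳ)

─-⊆ : ∀ {X Y} → X ─ Y ⊆ X
─-⊆ {X} {Y} x = ∈─⁻ˡ X Y

─-monoˡ : ∀ {X Y} K → X ⊆ Y → X ─ K ⊆ Y ─ K
─-monoˡ {X} {Y} K X⊆Y x p = ∈─ Y K (X⊆Y x (∈─⁻ˡ X K p)) (∈─⁻ʳ X K p)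

⁅⁆-⊆ : ∀ {y Z} → y ∈ Z → ⁅ y ⁆ ⊆ Z
⁅⁆-⊆ {y} {Z} y∈Z x p = subst (_∈ Z) (to (∈⁅⁆⇔ y x) p) y∈Z

infix 4 _≐_
_≐_ : Subset → Subset → Set
X ≐ Y = ∀ x → x ∈ X ⇔ x ∈ Y

─-swap : ∀ X K L → (X ─ K) ─ L ≐ (X ─ L) ─ K
─-swap X K L x = mk⇔ (swap K L) (swap L K)
  where
    swap : ∀ K L → x ∈ (X ─ K) ─ L → x ∈ (X ─ L) ─ K
    swap K L p = ∈─ (X ─ L) K (∈─ X L (∈─⁻ˡ X K p₁) (∈─⁻ʳ (X ─ K) L p)) (∈─⁻ʳ X K p₁)
      where p₁ = ∈─⁻ˡ (X ─ K) L p

─-congˡ : ∀ {X Y} K → X ≐ Y → X ─ K ≐ Y ─ K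
─-congˡ {X} {Y} K X≐Y x =
  mk⇔ (λ p → ∈─ Y K (to (X≐Y x) (∈─⁻ˡ X K p)) (∈─⁻ʳ X K p))
      (λ p → ∈─ X K (from (X≐Y x) (∈─⁻ˡ Y K p)) (∈─⁻ʳ Y K p))

≐-sym : ∀ {X Y} → X ≐ Y → Y ≐ X
≐-sym X≐Y x = mk⇔ (from (X≐Y x)) (to (X≐Y x))

≐-trans : ∀ {X Y Z} → X ≐ Y → Y ≐ Z → X ≐ Z
≐-trans X≐Y Y≐Z x = mk⇔ (λ p → to (Y≐Z x) (to (X≐Y x) p)) (λ p → from (X≐Y x) (from (Y≐Z x) p))

partition-cong : ∀ {C D S S'} → S ≐ S' → IsPartition C D S → IsPartition C D S'
partition-cong S≐S' part x =
  mk⇔ (λ p → to (S≐S' x) (to (proj₁ (part x)) p)) (λ p → from (proj₁ (part x)) (from (S≐S' x) p)) ,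
  proj₂ (part x)

partition-⊆ˡ : ∀ {C D S} → IsPartition C D S → C ⊆ S
partition-⊆ˡ part x p = to (proj₁ (part x)) (inj₁ p)

partition-⊆ʳ : ∀ {C D S} → IsPartition C D S → D ⊆ S
partition-⊆ʳ part x p = to (proj₁ (part x)) (inj₂ p)

partition-remainder : ∀ {C D S E} → S ⊆ E → IsPartition C D (E ─ S) → S ≐ (E ─ C) ─ D
partition-remainder {C} {D} {S} {E} S⊆E part x = mk⇔ keep back
  where
    keep : x ∈ S → x ∈ (E ─ C) ─ D
    keep x∈S = ∈─ (E ─ C) D (∈─ E C (S⊆E x x∈S) (λ c → ∈─⁻ʳ E S (partition-⊆ˡ part x c) x∈S))
                            (λ d → ∈─⁻ʳ E S (partition-⊆ʳ part x d) x∈S)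
    back : x ∈ (E ─ C) ─ D → x ∈ S
    back p = ∈-stable S λ x∉S →
      [ ∈─⁻ʳ E C (∈─⁻ˡ (E ─ C) D p) , ∈─⁻ʳ (E ─ C) D p ]′
        (from (proj₁ (part x)) (∈─ E S (∈─⁻ˡ E C (∈─⁻ˡ (E ─ C) D p)) x∉S))

count-cong : ∀ n {X Y} → (∀ x → x < n → X x ≡ Y x) → count n X ≡ count n Y
count-cong zero    eq = refl
count-cong (suc n) {X} {Y} eq rewrite eq n ≤-refl =
  cong ((if Y n then 1 else 0) +_) (count-cong n λ x x<n → eq x (m<n⇒m<1+n x<n))

count-∪-new : ∀ n {K y} → y ∉ K → y < n → count n (K ∪ ⁅ y ⁆) ≡ suc (count n K)
count-∪-new (suc n) {K} {y} y∉K y<1+n with m<1+n⇒m<n∨m≡n y<1+n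
... | inj₂ refl rewrite ∉⇒false K y∉K | to T-≡ (≡⇒≡ᵇ y y refl) =
  cong suc (count-cong y λ x x<y → unchanged x (<⇒≢ x<y ∘ sym))
  where
    unchanged : ∀ x → y ≢ x → K x ∨ (y ≡ᵇ x) ≡ K x
    unchanged x y≢x rewrite ∉⇒false ⁅ y ⁆ (∉⁅⁆ y≢x) = ∨-identityʳ (K x)
... | inj₁ y<n rewrite ∉⇒false ⁅ y ⁆ (∉⁅⁆ (<⇒≢ y<n)) | ∨-identityʳ (K n) =
  trans (cong ((if K n then 1 else 0) +_) (count-∪-new n y∉K y<n)) (+-suc _ (count n K))

dn-comprehension : (P : ℕ → Set) (m : ℕ) →
  ¬ ¬ (Σ Subset λ H → (∀ y → y ∈ H → ¬ P y) × (∀ y → y < m → y ∉ H → P y))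
dn-comprehension P zero = pure (∅ , (λ _ ()) , λ _ ())
dn-comprehension P (suc m) = do
  (H , H-fails , outside-holds) ← dn-comprehension P m
  Pm? ← ¬¬-excluded-middle
  pure (decide H H-fails outside-holds Pm?)
  where
    decide : ∀ H → (∀ y → y ∈ H → ¬ P y) → (∀ y → y < m → y ∉ H → P y) → Dec (P m) →
             Σ Subset λ H' → (∀ y → y ∈ H' → ¬ P y) × (∀ y → y < suc m → y ∉ H' → P y)
    decide H H-fails outside-holds (yes Pm) = H , H-fails , outside
      where
        outside : ∀ y → y < suc m → y ∉ H → P y
        outside y y<1+m y∉H with m<1+n⇒m<n∨m≡n y<1+m
        ... | inj₁ y<m  = outside-holds y y<m y∉H
        ... | inj₂ refl = Pm
    decide H H-fails outside-holds (no ¬Pm) = H ∪ ⁅ m ⁆ , fails , outside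
      where
        fails : ∀ y → y ∈ H ∪ ⁅ m ⁆ → ¬ P y
        fails y p = [ H-fails y , (λ y∈m → subst (λ z → ¬ P z) (to (∈⁅⁆⇔ m y) y∈m) ¬Pm) ]′ (∈∪⁻ H ⁅ m ⁆ p)
        outside : ∀ y → y < suc m → y ∉ H ∪ ⁅ m ⁆ → P y
        outside y y<1+m y∉H' with m<1+n⇒m<n∨m≡n y<1+m
        ... | inj₁ y<m  = outside-holds y y<m (λ y∈H → y∉H' (∈∪ˡ H ⁅ m ⁆ y∈H))
        ... | inj₂ refl = ⊥-elim (y∉H' (∈∪ʳ H ⁅ y ⁆ (∈⁅⁆ y)))

-- B absorbs K (in A): every element of K outside B is spanned by B, i.e. cannot be added to B independently.
Absorbs : PreMatroid → Subset → Subset → Set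
Absorbs A B K = ∀ y → y ∈ K → y ∉ B → ¬ Ind A (B ∪ ⁅ y ⁆)

absorbs-⊆ : ∀ {A B K L} → L ⊆ K → Absorbs A B K → Absorbs A B L
absorbs-⊆ L⊆K absK y y∈L = absK y (L⊆K y y∈L)

absorbs-∪ : ∀ {A B K L} → Absorbs A B K → Absorbs A B L → Absorbs A B (K ∪ L)
absorbs-∪ {K = K} {L} absK absL y p = [ absK y , absL y ]′ (∈∪⁻ K L p)

Hereditary : PreMatroid → Set
Hereditary A = ∀ {I J} → I ⊆ J → Ind A J → Ind A I

module _ (N : Matroid) where
  private
    b = bound N
    Indep = Ind (pre N)

  hered : Hereditary (pre N)
  hered {I} {J} = Ind-hered N I J

  below-bound : ∀ {I x} → Indep I → x ∈ I → x < b
  below-bound {I} {x} iI x∈I = E-bounded N x (Ind-⊆E N I iI x x∈I)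

  count-dominated : ∀ {B K} → Indep B → Indep K → Absorbs (pre N) B K → count b K ≤ count b B
  count-dominated {B} {K} iB iK absK =
    ≮⇒≥ λ B<K → let (y , y∈K , y∉B , iBy) = Ind-aug N B K iB iK B<K in absK y y∈K y∉B iBy

  augment-to : ∀ {I J} → Indep I → Indep J → count b I ≤ count b J →
               Σ Subset λ K → I ⊆ K × K ⊆ I ∪ J × Indep K × count b K ≡ count b J
  augment-to {I} {J} iI iJ I≤J =
    let (K , I⊆K , K⊆IJ , iK , |K|) = grow (count b J ∸ count b I) (≤-reflexive (m+[n∸m]≡n I≤J))
    in K , I⊆K , K⊆IJ , iK , trans |K| (m+[n∸m]≡n I≤J)
    where
      grow : ∀ m → count b I + m ≤ count b J →
             Σ Subset λ K → I ⊆ K × K ⊆ I ∪ J × Indep K × count b K ≡ count b I + m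
      grow zero _ = I , ⊆-refl , ⊆-∪ˡ , iI , sym (+-identityʳ _)
      grow (suc m) I+m<J
        with grow m (≤-trans (+-monoʳ-≤ (count b I) (n≤1+n m)) I+m<J)
      ... | K , I⊆K , K⊆IJ , iK , |K|
        with Ind-aug N K J iK iJ (subst (λ k → suc k ≤ count b J) (sym |K|)
                                        (subst (_≤ count b J) (+-suc (count b I) m) I+m<J))
      ... | y , y∈J , y∉K , iKy =
        K ∪ ⁅ y ⁆ , ⊆-trans I⊆K ⊆-∪ˡ , ∪-⊆ K⊆IJ (⁅⁆-⊆ (∈∪ʳ I J y∈J)) , iKy ,
        trans (count-∪-new b y∉K (below-bound iJ y∈J)) (trans (cong suc |K|) (sym (+-suc _ m)))

  rank-of-absorbing : ∀ {B A} → Indep B → B ⊆ A → Absorbs (pre N) B A → IsRank N A (count b B)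
  rank-of-absorbing iB B⊆A absA =
    (_ , B⊆A , iB , refl) , λ J J⊆A iJ → count-dominated iB iJ (absorbs-⊆ {pre N} J⊆A absA)

  absorbs-spanned : ∀ {B A x} → Indep B → Absorbs (pre N) B A → Spans N A x → x ∉ B → ¬ Indep (B ∪ ⁅ x ⁆)
  absorbs-spanned {B} {A} {x} iB absA (_ , k , ((IA , IA⊆A , iIA , |IA|≡k) , _) , (_ , rank-Ax)) x∉B iBx
    with x ∈? A
  ... | yes x∈A = absA x x∈A x∉B iBx
  ... | no  x∉A = conclude (augment-to iIA iBx IA≤Bx)
    where
      x<b : x < b
      x<b = below-bound iBx (∈∪ʳ B ⁅ x ⁆ (∈⁅⁆ x))
      |Bx| : count b (B ∪ ⁅ x ⁆) ≡ suc (count b B)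
      |Bx| = count-∪-new b x∉B x<b
      |IA|≤|B| : count b IA ≤ count b B
      |IA|≤|B| = count-dominated iB iIA (absorbs-⊆ {pre N} IA⊆A absA)
      IA≤Bx : count b IA ≤ count b (B ∪ ⁅ x ⁆)
      IA≤Bx = ≤-trans (≤-trans |IA|≤|B| (n≤1+n _)) (≤-reflexive (sym |Bx|))
      -- Grow IA inside IA ∪ B ∪ {x} to the size of B ∪ {x}.  If x was added, IA ∪ {x} is an
      -- independent subset of A ∪ {x} of size k + 1; otherwise the grown set is absorbed by B.
      conclude : (Σ Subset λ K → IA ⊆ K × K ⊆ IA ∪ (B ∪ ⁅ x ⁆) × Indep K × count b K ≡ count b (B ∪ ⁅ x ⁆)) → ⊥
      conclude (K , IA⊆K , K⊆ , iK , |K|) with x ∈? K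
      ... | yes x∈K = 1+n≰n (subst (_≤ k) |IAx| (rank-Ax (IA ∪ ⁅ x ⁆) (∪-mono IA⊆A ⊆-refl) iIAx))
        where
          |IAx| : count b (IA ∪ ⁅ x ⁆) ≡ suc k
          |IAx| = trans (count-∪-new b (λ x∈IA → x∉A (IA⊆A x x∈IA)) x<b) (cong suc |IA|≡k)
          iIAx : Indep (IA ∪ ⁅ x ⁆)
          iIAx = hered (∪-⊆ IA⊆K (⁅⁆-⊆ x∈K)) iK
      ... | no  x∉K = 1+n≰n (subst (_≤ count b B) (trans |K| |Bx|) (count-dominated iB iK absK))
        where
          absK : Absorbs (pre N) B K
          absK y y∈K y∉B with ∈∪⁻ IA (B ∪ ⁅ x ⁆) (K⊆ y y∈K)
          ... | inj₁ y∈IA = absA y (IA⊆A y y∈IA) y∉B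
          ... | inj₂ y∈Bx = [ (λ y∈B → ⊥-elim (y∉B y∈B)) ,
                              (λ y∈x → ⊥-elim (x∉K (subst (_∈ K) (sym (to (∈⁅⁆⇔ x y) y∈x)) y∈K))) ]′
                            (∈∪⁻ B ⁅ x ⁆ y∈Bx)

  -- Every S has (classically) a maximal independent subset, built greedily over 0, 1, …, b - 1.
  maximal-independent : ∀ S → ¬ ¬ (Σ Subset λ I → I ⊆ S × Indep I × Absorbs (pre N) I S)
  maximal-independent S = do
    (I , I⊆S , iI , absorbs-below) ← greedy b
    pure (I , I⊆S , iI , λ y y∈S y∉I iIy → absorbs-below y (below-bound iIy (∈∪ʳ I ⁅ y ⁆ (∈⁅⁆ y))) y∈S y∉I iIy)
    where
      AbsorbsBelow : ℕ → Subset → Set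
      AbsorbsBelow m I = ∀ y → y < m → y ∈ S → y ∉ I → ¬ Indep (I ∪ ⁅ y ⁆)

      Greedy : ℕ → Set
      Greedy m = Σ Subset λ I → I ⊆ S × Indep I × AbsorbsBelow m I

      step : ∀ m I → I ⊆ S → Indep I → AbsorbsBelow m I → Dec (Indep (I ∪ ⁅ m ⁆)) → Greedy (suc m)
      step m I I⊆S iI abs (yes iIm) with m ∈? S
      ... | yes m∈S = I ∪ ⁅ m ⁆ , ∪-⊆ I⊆S (⁅⁆-⊆ m∈S) , iIm , abs'
        where
          abs' : AbsorbsBelow (suc m) (I ∪ ⁅ m ⁆)
          abs' y y<1+m y∈S y∉Im iImy with m<1+n⇒m<n∨m≡n y<1+m
          ... | inj₁ y<m  = abs y y<m y∈S (λ y∈I → y∉Im (∈∪ˡ I ⁅ m ⁆ y∈I))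
                              (hered (∪-mono {I} {⁅ y ⁆} ⊆-∪ˡ ⊆-refl) iImy)
          ... | inj₂ refl = y∉Im (∈∪ʳ I ⁅ y ⁆ (∈⁅⁆ y))
      ... | no m∉S = I , I⊆S , iI , abs'
        where
          abs' : AbsorbsBelow (suc m) I
          abs' y y<1+m y∈S with m<1+n⇒m<n∨m≡n y<1+m
          ... | inj₁ y<m  = abs y y<m y∈S
          ... | inj₂ refl = ⊥-elim (m∉S y∈S)
      step m I I⊆S iI abs (no ¬iIm) = I , I⊆S , iI , abs'
        where
          abs' : AbsorbsBelow (suc m) I
          abs' y y<1+m y∈S with m<1+n⇒m<n∨m≡n y<1+m
          ... | inj₁ y<m  = abs y y<m y∈S
          ... | inj₂ refl = λ _ → ¬iIm

      greedy : ∀ m → ¬ ¬ Greedy m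
      greedy zero    = pure (∅ , (λ _ ()) , Ind-∅ N , λ _ ())
      greedy (suc m) = do
        (I , I⊆S , iI , abs) ← greedy m
        dec ← ¬¬-excluded-middle
        pure (step m I I⊆S iI abs dec)

  spans-member : ∀ {X x} → x ∈ X → x ∈ E (pre N) → ¬ ¬ Spans N X x
  spans-member {X} {x} x∈X x∈E = do
    (I , I⊆X , iI , absX) ← maximal-independent X
    pure (x∈E , count b I , rank-of-absorbing iI I⊆X absX ,
          rank-of-absorbing iI (⊆-trans I⊆X ⊆-∪ˡ) (absorbs-∪ {pre N} absX (absorbs-⊆ {pre N} (⁅⁆-⊆ x∈X) absX)))

  closure-flat : ∀ {B} → Indep B → ¬ ¬ (Σ Subset λ G → B ⊆ G × IsFlat N G × Absorbs (pre N) B G)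
  closure-flat {B} iB = do
    (H , H-fails , outside-holds) ← dn-comprehension Augments b
    pure (flat-of H H-fails outside-holds)
    where
      Augments : ℕ → Set
      Augments y = y ∈ E (pre N) → Indep (B ∪ ⁅ y ⁆)

      flat-of : ∀ H → (∀ y → y ∈ H → ¬ Augments y) → (∀ y → y < b → y ∉ H → Augments y) →
                Σ Subset λ G → B ⊆ G × IsFlat N G × Absorbs (pre N) B G
      flat-of H H-fails outside-holds = B ∪ H , ⊆-∪ˡ , (G⊆E , closed) , absG
        where
          H⊆E : H ⊆ E (pre N)
          H⊆E y y∈H = ∈-stable (E (pre N)) λ y∉E → H-fails y y∈H (λ y∈E → ⊥-elim (y∉E y∈E))
          G⊆E : B ∪ H ⊆ E (pre N)
          G⊆E = ∪-⊆ (Ind-⊆E N B iB) H⊆E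
          absG : Absorbs (pre N) B (B ∪ H)
          absG y y∈G y∉B iBy = [ y∉B , (λ y∈H → H-fails y y∈H (λ _ → iBy)) ]′ (∈∪⁻ B H y∈G)
          closed : ∀ e → Spans N (B ∪ H) e → e ∈ B ∪ H
          closed e spans = ∈-stable (B ∪ H) λ e∉G →
            absorbs-spanned iB absG spans (λ e∈B → e∉G (∈∪ˡ B H e∈B))
              (outside-holds e (E-bounded N e (proj₁ spans)) (λ e∈H → e∉G (∈∪ʳ B H e∈H)) (proj₁ spans))

＼-hereditary : ∀ {A} K → Hereditary A → Hereditary (A ＼ K)
＼-hereditary K hA I⊆J (J⊆E , iJ) = ⊆-trans I⊆J J⊆E , hA I⊆J iJ

／-hereditary : ∀ {A} K → Hereditary A → Hereditary (A ／ K)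
／-hereditary K hA I⊆J (J⊆E , B , basis , iJB) = ⊆-trans I⊆J J⊆E , B , basis , hA (∪-mono I⊆J ⊆-refl) iJB

Agree : PreMatroid → PreMatroid → Subset → Set
Agree A A' S = ∀ J → J ⊆ S → Ind A J ⇔ Ind A' J

agree-sym : ∀ {A A' S} → Agree A A' S → Agree A' A S
agree-sym agree J J⊆S = mk⇔ (from (agree J J⊆S)) (to (agree J J⊆S))

agree-trans : ∀ {A A' A'' S} → Agree A A' S → Agree A' A'' S → Agree A A'' S
agree-trans agree agree' J J⊆S =
  mk⇔ (λ i → to (agree' J J⊆S) (to (agree J J⊆S) i)) (λ i → from (agree J J⊆S) (from (agree' J J⊆S) i))

agree-⊆ : ∀ {A A' S S'} → S' ⊆ S → Agree A A' S → Agree A A' S'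
agree-⊆ S'⊆S agree J J⊆S' = agree J (⊆-trans J⊆S' S'⊆S)

absorbs-transfer : ∀ {A A' S B K} → Agree A A' S → B ⊆ S → K ⊆ S → Absorbs A B K → Absorbs A' B K
absorbs-transfer agree B⊆S K⊆S absK y y∈K y∉B iBy =
  absK y y∈K y∉B (from (agree _ (∪-⊆ B⊆S (⁅⁆-⊆ (K⊆S y y∈K)))) iBy)

agree-deletion : ∀ A K → Agree A (A ＼ K) (E A ─ K)
agree-deletion A K J J⊆ = mk⇔ (λ i → J⊆ , i) proj₂

basis-transfer : ∀ {A A' S B C} → Agree A A' S → C ⊆ S → IsBasisOf A B C → IsBasisOf A' B C
basis-transfer agree C⊆S (B⊆C , iB , maximal) =
  B⊆C , to (agree _ (⊆-trans B⊆C C⊆S)) iB ,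
  λ J B⊆J J⊆C iJ → maximal J B⊆J J⊆C (from (agree J (⊆-trans J⊆C C⊆S)) iJ)

contraction-transfer : ∀ {A A' S C I} → Agree A A' S → C ⊆ S → I ⊆ S →
  Σ Subset (λ B → IsBasisOf A B C × Ind A (I ∪ B)) → Σ Subset (λ B → IsBasisOf A' B C × Ind A' (I ∪ B))
contraction-transfer {A} {A'} agree C⊆S I⊆S (B , basis , iIB) =
  B , basis-transfer {A} {A'} agree C⊆S basis , to (agree _ (∪-⊆ I⊆S (⊆-trans (proj₁ basis) C⊆S))) iIB

agree-＼ : ∀ {A A' S} K → S ⊆ E A → S ⊆ E A' → Agree A A' S → Agree (A ＼ K) (A' ＼ K) (S ─ K)
agree-＼ K S⊆E S⊆E' agree J J⊆ =
  mk⇔ (λ (_ , i) → ⊆-trans J⊆ (─-monoˡ K S⊆E') , to (agree J (⊆-trans J⊆ ─-⊆)) i)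
      (λ (_ , i) → ⊆-trans J⊆ (─-monoˡ K S⊆E) , from (agree J (⊆-trans J⊆ ─-⊆)) i)

agree-／ : ∀ {A A' S} K → S ⊆ E A → S ⊆ E A' → K ⊆ S → Agree A A' S → Agree (A ／ K) (A' ／ K) (S ─ K)
agree-／ {A} {A'} {S} K S⊆E S⊆E' K⊆S agree J J⊆ =
  mk⇔ (λ (_ , witness) → ⊆-trans J⊆ (─-monoˡ K S⊆E') , contraction-transfer {A} {A'} agree K⊆S J⊆S witness)
      (λ (_ , witness) → ⊆-trans J⊆ (─-monoˡ K S⊆E) ,
                         contraction-transfer {A'} {A} (agree-sym {A} {A'} agree) K⊆S J⊆S witness)
  where
    J⊆S : J ⊆ S
    J⊆S = ⊆-trans J⊆ ─-⊆

ContractFree : PreMatroid → Subset → Subset → Set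
ContractFree A C X = ∀ I → I ⊆ X → Σ Subset λ B → IsBasisOf A B C × Ind A (I ∪ B)

LoopsAfter : PreMatroid → Subset → Subset → Set
LoopsAfter A C Y = ∀ B → IsBasisOf A B C → Absorbs A B Y

record IsoMinorVia (A : PreMatroid) (X Y C D : Subset) : Set where
  field
    ground    : X ∪ Y ⊆ E A
    partition : IsPartition C D (E A ─ (X ∪ Y))
    free      : ContractFree A C X
    loops     : LoopsAfter A C Y

  C⊆ : C ⊆ E A ─ (X ∪ Y)
  C⊆ = partition-⊆ˡ partition

  remainder : X ∪ Y ≐ (E A ─ C) ─ D
  remainder = partition-remainder ground partition
open IsoMinorVia

iso-minor-sound : ∀ {A X Y C D} → Hereditary A → IsoMinorVia A X Y C D → IsMinor (iso X (X ∪ Y)) A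
iso-minor-sound {A} {X} {Y} {C} {D} hA via =
  ground via , C , D , partition via , remainder via , λ I → mk⇔ (into I) (onto I)
  where
    into : ∀ I → I ⊆ X → Ind ((A ／ C) ＼ D) I
    into I I⊆X = I⊆ECD , ⊆-trans I⊆ECD ─-⊆ , free via I I⊆X
      where
        I⊆ECD : I ⊆ (E A ─ C) ─ D
        I⊆ECD x x∈I = to (remainder via x) (∈∪ˡ X Y (I⊆X x x∈I))
    -- an element of an independent I outside X lies in Y, hence is a loop of A / C
    onto : ∀ I → Ind ((A ／ C) ＼ D) I → I ⊆ X
    onto I (I⊆ECD , _ , B , basis , iIB) x x∈I = ∈-stable X λ x∉X →
      loops via B basis x (in-Y x∉X) (λ x∈B → ∈─⁻ʳ (E A) C x∈EA─C (proj₁ basis x x∈B))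
        (hA Bx⊆IB iIB)
      where
        Bx⊆IB : B ∪ ⁅ x ⁆ ⊆ I ∪ B
        Bx⊆IB = ∪-⊆ {B} ⊆-∪ʳ (⁅⁆-⊆ (∈∪ˡ I B x∈I))
        x∈EA─C : x ∈ E A ─ C
        x∈EA─C = ∈─⁻ˡ (E A ─ C) D (I⊆ECD x x∈I)
        in-Y : x ∉ X → x ∈ Y
        in-Y x∉X = [ (λ x∈X → ⊥-elim (x∉X x∈X)) , (λ x∈Y → x∈Y) ]′
                     (∈∪⁻ X Y (from (remainder via x) (I⊆ECD x x∈I)))

iso-minor-complete : ∀ {A X Y} → Hereditary A → Disjoint X Y → IsMinor (iso X (X ∪ Y)) A →
                     Σ Subset λ C → Σ Subset λ D → IsoMinorVia A X Y C D
iso-minor-complete {A} {X} {Y} hA disjoint (ground , C , D , partition , same-E , same-Ind) =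
  C , D , record { ground = ground ; partition = partition ; free = X-free ; loops = Y-loops }
  where
    X-free : ContractFree A C X
    X-free I I⊆X = proj₂ (proj₂ (to (same-Ind I) I⊆X))
    -- if B ∪ {y} were independent, {y} would be independent in iso(X, X ∪ Y), i.e. y ∈ X
    Y-loops : LoopsAfter A C Y
    Y-loops B basis y y∈Y _ iBy = disjoint y (from (same-Ind ⁅ y ⁆) y-indep y (∈⁅⁆ y)) y∈Y
      where
        y⊆ECD : ⁅ y ⁆ ⊆ (E A ─ C) ─ D
        y⊆ECD = ⁅⁆-⊆ (to (same-E y) (∈∪ʳ X Y y∈Y))
        y-indep : Ind ((A ／ C) ＼ D) ⁅ y ⁆
        y-indep = y⊆ECD , ⊆-trans y⊆ECD ─-⊆ , B , basis , hA yB⊆By iBy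
          where
            yB⊆By : ⁅ y ⁆ ∪ B ⊆ B ∪ ⁅ y ⁆
            yB⊆By = ∪-⊆ {⁅ y ⁆} ⊆-∪ʳ ⊆-∪ˡ

iso-minor-transfer : ∀ {A A' S X Y Y' C D} → Agree A A' S → Disjoint X Y →
  E A ─ Y ⊆ S → S ⊆ E A' → Y' ⊆ E A' → E A ─ (X ∪ Y) ≐ E A' ─ (X ∪ Y') →
  (C ⊆ S → LoopsAfter A C Y → LoopsAfter A' C Y') →
  IsoMinorVia A X Y C D → IsoMinorVia A' X Y' C D
iso-minor-transfer {A} {A'} {S} {X} {Y} {Y'} {C} agree disjoint EA─Y⊆S S⊆EA' Y'⊆EA' same-rest transfer-loops via =
  record { ground    = ∪-⊆ (⊆-trans X⊆S S⊆EA') Y'⊆EA'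
         ; partition = partition-cong same-rest (partition via)
         ; free      = λ I I⊆X → contraction-transfer {A} {A'} agree C⊆S (⊆-trans I⊆X X⊆S) (free via I I⊆X)
         ; loops     = transfer-loops C⊆S (loops via) }
  where
    X⊆S : X ⊆ S
    X⊆S x x∈X = EA─Y⊆S x (∈─ (E A) Y (ground via x (∈∪ˡ X Y x∈X)) (disjoint x x∈X))
    C⊆S : C ⊆ S
    C⊆S x x∈C = EA─Y⊆S x (∈─ (E A) Y (∈─⁻ˡ (E A) (X ∪ Y) (C⊆ via x x∈C))
                                      (λ x∈Y → ∈─⁻ʳ (E A) (X ∪ Y) (C⊆ via x x∈C) (∈∪ʳ X Y x∈Y)))

iso-minor-transport : ∀ {A A' X Y Y'} → Hereditary A → Hereditary A' → Disjoint X Y →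
  (∀ {C D} → IsoMinorVia A X Y C D → IsoMinorVia A' X Y' C D) →
  IsMinor (iso X (X ∪ Y)) A → IsMinor (iso X (X ∪ Y')) A'
iso-minor-transport hA hA' disjoint transform minor =
  let (C , D , via) = iso-minor-complete hA disjoint minor in iso-minor-sound hA' (transform via)

module FreeAddition
  (X₁ X₂ : Subset) (disjoint : Disjoint X₁ X₂)
  (M : Matroid) (fragile : Fragile (iso X₁ (X₁ ∪ X₂)) (pre M))
  (F : Subset) (F-closure : IsClosure M X₂ F)
  (d : ℕ) (M' : Matroid) (added : AddedFreely M M' F d) where

  E₀ E₁ : Subset
  E₀ = E (pre M)
  E₁ = E (pre M')

  P' : PreMatroid
  P' = pre M' ＼ X₂

  N N' : PreMatroid
  N  = iso X₁ (X₁ ∪ X₂)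
  N' = iso X₁ (X₁ ∪ ⁅ d ⁆)

  P'-hereditary : Hereditary P'
  P'-hereditary = ＼-hereditary X₂ (hered M')

  private
    d∉E₀ : d ∉ E₀
    d∉E₀ = proj₁ added
    E₁-split : ∀ x → x ∈ E₁ ⇔ (x ∈ E₀ ⊎ x ≡ d)
    E₁-split = proj₁ (proj₂ added)
    M≅M'＼d : pre M ≅ (pre M' ＼ ⁅ d ⁆)
    M≅M'＼d = proj₁ (proj₂ (proj₂ added))
    F-spans-d : Spans M' F d
    F-spans-d = proj₁ (proj₂ (proj₂ (proj₂ added)))
    freeness : ∀ G → IsFlat M G → Spans M' G d → F ⊆ G
    freeness = proj₂ (proj₂ (proj₂ (proj₂ added)))

  E₀⊆E₁ : E₀ ⊆ E₁
  E₀⊆E₁ x x∈E₀ = from (E₁-split x) (inj₁ x∈E₀)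

  d∈E₁ : d ∈ E₁
  d∈E₁ = from (E₁-split d) (inj₂ refl)

  E₀-avoids-d : ∀ {x} → x ∈ E₀ → d ≢ x
  E₀-avoids-d x∈E₀ refl = d∉E₀ x∈E₀

  E₁-other : ∀ {x} → x ∈ E₁ → d ≢ x → x ∈ E₀
  E₁-other {x} x∈E₁ d≢x = [ (λ x∈E₀ → x∈E₀) , (λ x≡d → ⊥-elim (d≢x (sym x≡d))) ]′ (to (E₁-split x) x∈E₁)

  X₁∪X₂⊆E₀ : X₁ ∪ X₂ ⊆ E₀
  X₁∪X₂⊆E₀ = proj₁ (proj₁ fragile)

  X₂⊆E₀ : X₂ ⊆ E₀
  X₂⊆E₀ = ⊆-trans ⊆-∪ʳ X₁∪X₂⊆E₀

  F⊆E₀ : F ⊆ E₀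
  F⊆E₀ x x∈F = proj₁ (to (F-closure x) x∈F)

  X₁-avoids-d : Disjoint X₁ ⁅ d ⁆
  X₁-avoids-d x x∈X₁ = ∉⁅⁆ (E₀-avoids-d (X₁∪X₂⊆E₀ x (∈∪ˡ X₁ X₂ x∈X₁)))

  E₀─X₂⊆P' : E₀ ─ X₂ ⊆ E P'
  E₀─X₂⊆P' = ─-monoˡ X₂ E₀⊆E₁

  d∈P' : d ∈ E P'
  d∈P' = ∈─ E₁ X₂ d∈E₁ (λ d∈X₂ → d∉E₀ (X₂⊆E₀ d d∈X₂))

  rest-P' : E₀ ─ (X₁ ∪ X₂) ≐ E P' ─ (X₁ ∪ ⁅ d ⁆)
  rest-P' x = mk⇔ there back
    where
      there : x ∈ E₀ ─ (X₁ ∪ X₂) → x ∈ E P' ─ (X₁ ∪ ⁅ d ⁆)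
      there p = ∈─ (E P') (X₁ ∪ ⁅ d ⁆) (∈─ E₁ X₂ (E₀⊆E₁ x x∈E₀) (λ x∈X₂ → x∉N (∈∪ʳ X₁ X₂ x∈X₂)))
                   (∉∪ X₁ ⁅ d ⁆ (λ x∈X₁ → x∉N (∈∪ˡ X₁ X₂ x∈X₁)) (∉⁅⁆ (E₀-avoids-d x∈E₀)))
        where
          x∈E₀ = ∈─⁻ˡ E₀ (X₁ ∪ X₂) p
          x∉N  = ∈─⁻ʳ E₀ (X₁ ∪ X₂) p
      back : x ∈ E P' ─ (X₁ ∪ ⁅ d ⁆) → x ∈ E₀ ─ (X₁ ∪ X₂)
      back p = ∈─ E₀ (X₁ ∪ X₂) (E₁-other (∈─⁻ˡ E₁ X₂ x∈P') (λ d≡x → x∉N' (∈∪ʳ X₁ ⁅ d ⁆ (from (∈⁅⁆⇔ d x) d≡x))))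
                  (∉∪ X₁ X₂ (λ x∈X₁ → x∉N' (∈∪ˡ X₁ ⁅ d ⁆ x∈X₁)) (∈─⁻ʳ E₁ X₂ x∈P'))
        where
          x∈P' = ∈─⁻ˡ (E P') (X₁ ∪ ⁅ d ⁆) p
          x∉N' = ∈─⁻ʳ (E P') (X₁ ∪ ⁅ d ⁆) p

  agree-MM' : Agree (pre M) (pre M') E₀
  agree-MM' J J⊆E₀ = mk⇔ (λ i → proj₂ (to (proj₂ M≅M'＼d J) i))
                         (λ i → from (proj₂ M≅M'＼d J) (J⊆E₁─d , i))
    where
      J⊆E₁─d : J ⊆ E₁ ─ ⁅ d ⁆
      J⊆E₁─d x x∈J = ∈─ E₁ ⁅ d ⁆ (E₀⊆E₁ x (J⊆E₀ x x∈J)) (∉⁅⁆ (E₀-avoids-d (J⊆E₀ x x∈J)))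

  agree-MP' : Agree (pre M) P' (E₀ ─ X₂)
  agree-MP' = agree-trans {pre M} {pre M'} {P'} {E₀ ─ X₂} (agree-⊆ {pre M} {pre M'} ─-⊆ agree-MM')
                          (agree-⊆ {pre M'} {P'} E₀─X₂⊆P' (agree-deletion (pre M') X₂))

  -- If B spans X₂, it spans F = cl(X₂) in M, and hence spans d in M' (as F does).
  X₂-absorbed⇒d-spanned : ∀ {B} → Ind (pre M) B → Absorbs (pre M) B X₂ → ¬ Ind (pre M') (B ∪ ⁅ d ⁆)
  X₂-absorbed⇒d-spanned {B} iB absX₂ =
    absorbs-spanned M' (to (agree-MM' B B⊆E₀) iB) absF' F-spans-d (λ d∈B → d∉E₀ (B⊆E₀ d d∈B))
    where
      B⊆E₀ : B ⊆ E₀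
      B⊆E₀ = Ind-⊆E M B iB
      absF : Absorbs (pre M) B F
      absF x x∈F = absorbs-spanned M iB absX₂ (to (F-closure x) x∈F)
      absF' : Absorbs (pre M') B F
      absF' = absorbs-transfer {pre M} {pre M'} agree-MM' B⊆E₀ F⊆E₀ absF

  -- Conversely, if B spans d in M' then the closure G of B in M is a flat that spans d in M';
  -- since d was added freely to F, G contains F, so B spans F.
  d-spanned⇒F-absorbed : ∀ {B} → Ind (pre M) B → ¬ Ind (pre M') (B ∪ ⁅ d ⁆) → Absorbs (pre M) B F
  d-spanned⇒F-absorbed {B} iB dep x x∈F x∉B iBx = closure-flat M iB λ (G , B⊆G , G-flat , absG) →
    absG x (freeness G G-flat (G-spans-d G B⊆G G-flat absG) x x∈F) x∉B iBx
    where
      iB' : Ind (pre M') B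
      iB' = to (agree-MM' B (Ind-⊆E M B iB)) iB
      G-spans-d : ∀ G → B ⊆ G → IsFlat M G → Absorbs (pre M) B G → Spans M' G d
      G-spans-d G B⊆G (G⊆E₀ , _) absG =
        d∈E₁ , _ , rank-of-absorbing M' iB' B⊆G absG' ,
                   rank-of-absorbing M' iB' (⊆-trans B⊆G ⊆-∪ˡ) (absorbs-∪ {pre M'} absG' absd)
        where
          absG' : Absorbs (pre M') B G
          absG' = absorbs-transfer {pre M} {pre M'} agree-MM' (⊆-trans B⊆G G⊆E₀) G⊆E₀ absG
          absd : Absorbs (pre M') B ⁅ d ⁆
          absd y y∈d _ = subst (λ z → ¬ Ind (pre M') (B ∪ ⁅ z ⁆)) (to (∈⁅⁆⇔ d y) y∈d) dep

  -- ... and F = cl(X₂) contains X₂.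
  d-spanned⇒X₂-absorbed : ∀ {B} → Ind (pre M) B → ¬ Ind (pre M') (B ∪ ⁅ d ⁆) → Absorbs (pre M) B X₂
  d-spanned⇒X₂-absorbed iB dep x x∈X₂ x∉B iBx =
    spans-member M x∈X₂ (X₂⊆E₀ x x∈X₂) λ X₂-spans-x →
      d-spanned⇒F-absorbed iB dep x (from (F-closure x) X₂-spans-x) x∉B iBx

  -- N' = iso(X₁, X₁ ∪ {d}) is a minor of P' = M' \ X₂, via the same (C , D) as N in M.
  minor-P' : ∀ {C D} → IsoMinorVia (pre M) X₁ X₂ C D → IsoMinorVia P' X₁ ⁅ d ⁆ C D
  minor-P' = iso-minor-transfer {pre M} {P'} agree-MP' disjoint ⊆-refl E₀─X₂⊆P' (⁅⁆-⊆ d∈P') rest-P' loops-d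
    where
      -- a basis of C absorbs X₂ (these are loops of M / C), so it spans d in M'
      loops-d : ∀ {C} → C ⊆ E₀ ─ X₂ → LoopsAfter (pre M) C X₂ → LoopsAfter P' C ⁅ d ⁆
      loops-d {C} C⊆S loops B basis y y∈d _ (_ , iBy) =
        X₂-absorbed⇒d-spanned iB (loops B basisM)
          (subst (λ z → Ind (pre M') (B ∪ ⁅ z ⁆)) (sym (to (∈⁅⁆⇔ d y) y∈d)) iBy)
        where
          basisM : IsBasisOf (pre M) B C
          basisM = basis-transfer {P'} {pre M} (agree-sym {pre M} {P'} agree-MP') C⊆S basis
          iB : Ind (pre M) B
          iB = proj₁ (proj₂ basisM)

  N'-minor-P' : IsMinor N' P'
  N'-minor-P' = iso-minor-transport (hered M) P'-hereditary disjoint minor-P' (proj₁ fragile)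

  -- Deleting or contracting an element e ∈ E₀ - X₂: the pair (M \ e , P' \ e), resp.
  -- (M / e , P' / e), is related exactly like (M , P').
  module WithoutElement {e : ℕ} (e∈E₀─X₂ : e ∈ E₀ ─ X₂) where

    S : Subset
    S = (E₀ ─ X₂) ─ ⁅ e ⁆

    e∈E₀ : e ∈ E₀
    e∈E₀ = ∈─⁻ˡ E₀ X₂ e∈E₀─X₂

    d∉S : d ∉ S
    d∉S d∈S = d∉E₀ (∈─⁻ˡ E₀ X₂ (∈─⁻ˡ (E₀ ─ X₂) ⁅ e ⁆ d∈S))

    S⊆E₀─e : S ⊆ E₀ ─ ⁅ e ⁆
    S⊆E₀─e = ─-monoˡ ⁅ e ⁆ ─-⊆

    S⊆P'─e : S ⊆ E P' ─ ⁅ e ⁆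
    S⊆P'─e = ─-monoˡ ⁅ e ⁆ E₀─X₂⊆P'

    X₂⊆E₀─e : X₂ ⊆ E₀ ─ ⁅ e ⁆
    X₂⊆E₀─e x x∈X₂ = ∈─ E₀ ⁅ e ⁆ (X₂⊆E₀ x x∈X₂)
                        (λ x∈e → ∈─⁻ʳ E₀ X₂ e∈E₀─X₂ (subst (_∈ X₂) (sym (to (∈⁅⁆⇔ e x) x∈e)) x∈X₂))

    d∈P'─e : d ∈ E P' ─ ⁅ e ⁆
    d∈P'─e = ∈─ (E P') ⁅ e ⁆ d∈P' (∉⁅⁆ (λ e≡d → E₀-avoids-d e∈E₀ (sym e≡d)))

    P'─e─d⊆S : (E P' ─ ⁅ e ⁆) ─ ⁅ d ⁆ ⊆ S
    P'─e─d⊆S x p = ∈─ (E₀ ─ X₂) ⁅ e ⁆ (∈─ E₀ X₂ x∈E₀ (∈─⁻ʳ E₁ X₂ x∈P')) (∈─⁻ʳ (E P') ⁅ e ⁆ x∈P'─e)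
      where
        x∈P'─e = ∈─⁻ˡ (E P' ─ ⁅ e ⁆) ⁅ d ⁆ p
        x∈P'   = ∈─⁻ˡ (E P') ⁅ e ⁆ x∈P'─e
        x∈E₀   = E₁-other (∈─⁻ˡ E₁ X₂ x∈P') (λ d≡x → ∈─⁻ʳ (E P' ─ ⁅ e ⁆) ⁅ d ⁆ p (from (∈⁅⁆⇔ d x) d≡x))

    rest-e : (E P' ─ ⁅ e ⁆) ─ (X₁ ∪ ⁅ d ⁆) ≐ (E₀ ─ ⁅ e ⁆) ─ (X₁ ∪ X₂)
    rest-e = ≐-trans (─-swap (E P') ⁅ e ⁆ (X₁ ∪ ⁅ d ⁆))
             (≐-trans (─-congˡ ⁅ e ⁆ (≐-sym rest-P')) (─-swap E₀ (X₁ ∪ X₂) ⁅ e ⁆))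

    Bd⊆P'─e : ∀ {B} → B ⊆ S → B ∪ ⁅ d ⁆ ⊆ E P' ─ ⁅ e ⁆
    Bd⊆P'─e B⊆S = ∪-⊆ (⊆-trans B⊆S S⊆P'─e) (⁅⁆-⊆ d∈P'─e)

    agree-＼e : Agree (P' ＼ ⁅ e ⁆) (pre M ＼ ⁅ e ⁆) S
    agree-＼e = agree-＼ {P'} {pre M} ⁅ e ⁆ E₀─X₂⊆P' ─-⊆ (agree-sym {pre M} {P'} agree-MP')

    agree-／e : Agree (P' ／ ⁅ e ⁆) (pre M ／ ⁅ e ⁆) S
    agree-／e = agree-／ {P'} {pre M} ⁅ e ⁆ E₀─X₂⊆P' ─-⊆ (⁅⁆-⊆ e∈E₀─X₂) (agree-sym {pre M} {P'} agree-MP')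

    -- A basis B of C in M \ e spans d in M' (d is a loop of P' \ e / C), hence spans X₂.
    loops-＼ : ∀ {C} → C ⊆ S → LoopsAfter (P' ＼ ⁅ e ⁆) C ⁅ d ⁆ → LoopsAfter (pre M ＼ ⁅ e ⁆) C X₂
    loops-＼ {C} C⊆S loops B basis x x∈X₂ x∉B (_ , iBx) =
      d-spanned⇒X₂-absorbed (proj₂ (proj₁ (proj₂ basis))) dep x x∈X₂ x∉B iBx
      where
        B⊆S : B ⊆ S
        B⊆S = ⊆-trans (proj₁ basis) C⊆S
        basis' : IsBasisOf (P' ＼ ⁅ e ⁆) B C
        basis' = basis-transfer {pre M ＼ ⁅ e ⁆} {P' ＼ ⁅ e ⁆}
                   (agree-sym {P' ＼ ⁅ e ⁆} {pre M ＼ ⁅ e ⁆} agree-＼e) C⊆S basis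
        dep : ¬ Ind (pre M') (B ∪ ⁅ d ⁆)
        dep iBd = loops B basis' d (∈⁅⁆ d) (λ d∈B → d∉S (B⊆S d d∈B))
                    (Bd⊆P'─e B⊆S , ⊆-trans (Bd⊆P'─e B⊆S) ─-⊆ , iBd)

    -- For M / e the basis of C is enlarged by a basis Bₑ of {e}; B ∪ Bₑ then spans d in M'.
    loops-／ : ∀ {C} → C ⊆ S → LoopsAfter (P' ／ ⁅ e ⁆) C ⁅ d ⁆ → LoopsAfter (pre M ／ ⁅ e ⁆) C X₂
    loops-／ {C} C⊆S loops B basis x x∈X₂ x∉B (_ , Bₑ , basisₑ , iBxBₑ) =
      d-spanned⇒X₂-absorbed iB' dep x x∈X₂ x∉B' (hered M B'x⊆BxBₑ iBxBₑ)
      where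
        B⊆S : B ⊆ S
        B⊆S = ⊆-trans (proj₁ basis) C⊆S
        B' : Subset
        B' = B ∪ Bₑ
        B'⊆BxBₑ : B' ⊆ (B ∪ ⁅ x ⁆) ∪ Bₑ
        B'⊆BxBₑ = ∪-mono {B} ⊆-∪ˡ ⊆-refl
        B'x⊆BxBₑ : B' ∪ ⁅ x ⁆ ⊆ (B ∪ ⁅ x ⁆) ∪ Bₑ
        B'x⊆BxBₑ = ∪-⊆ {B'} B'⊆BxBₑ (⊆-trans (⊆-∪ʳ {B}) ⊆-∪ˡ)
        iB' : Ind (pre M) B'
        iB' = hered M B'⊆BxBₑ iBxBₑ
        x∉B' : x ∉ B'
        x∉B' x∈B' = [ x∉B , (λ x∈Bₑ → ∈─⁻ʳ E₀ X₂ e∈E₀─X₂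
                                         (subst (_∈ X₂) (sym (to (∈⁅⁆⇔ e x) (proj₁ basisₑ x x∈Bₑ))) x∈X₂)) ]′
                    (∈∪⁻ B Bₑ x∈B')
        basis' : IsBasisOf (P' ／ ⁅ e ⁆) B C
        basis' = basis-transfer {pre M ／ ⁅ e ⁆} {P' ／ ⁅ e ⁆}
                   (agree-sym {P' ／ ⁅ e ⁆} {pre M ／ ⁅ e ⁆} agree-／e) C⊆S basis
        basisₑ' : IsBasisOf P' Bₑ ⁅ e ⁆
        basisₑ' = basis-transfer {pre M} {P'} agree-MP' (⁅⁆-⊆ e∈E₀─X₂) basisₑ
        BdBₑ⊆P' : (B ∪ ⁅ d ⁆) ∪ Bₑ ⊆ E P'
        BdBₑ⊆P' = ∪-⊆ {B ∪ ⁅ d ⁆} (⊆-trans (Bd⊆P'─e B⊆S) ─-⊆)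
                      (⊆-trans (proj₁ basisₑ) (⁅⁆-⊆ (E₀─X₂⊆P' e e∈E₀─X₂)))
        BdBₑ⊆B'd : (B ∪ ⁅ d ⁆) ∪ Bₑ ⊆ B' ∪ ⁅ d ⁆
        BdBₑ⊆B'd = ∪-⊆ {B ∪ ⁅ d ⁆} (∪-mono {B} ⊆-∪ˡ ⊆-refl) (⊆-trans (⊆-∪ʳ {B}) ⊆-∪ˡ)
        dep : ¬ Ind (pre M') (B' ∪ ⁅ d ⁆)
        dep iB'd = loops B basis' d (∈⁅⁆ d) (λ d∈B → d∉S (B⊆S d d∈B))
                     (Bd⊆P'─e B⊆S , Bₑ , basisₑ' , BdBₑ⊆P' , hered M' BdBₑ⊆B'd iB'd)

    minor-＼ : IsMinor N' (P' ＼ ⁅ e ⁆) → IsMinor N (pre M ＼ ⁅ e ⁆)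
    minor-＼ = iso-minor-transport (＼-hereditary ⁅ e ⁆ P'-hereditary) (＼-hereditary ⁅ e ⁆ (hered M))
                 X₁-avoids-d
                 (iso-minor-transfer {P' ＼ ⁅ e ⁆} {pre M ＼ ⁅ e ⁆} agree-＼e X₁-avoids-d
                    P'─e─d⊆S S⊆E₀─e X₂⊆E₀─e rest-e loops-＼)

    minor-／ : IsMinor N' (P' ／ ⁅ e ⁆) → IsMinor N (pre M ／ ⁅ e ⁆)
    minor-／ = iso-minor-transport (／-hereditary ⁅ e ⁆ P'-hereditary) (／-hereditary ⁅ e ⁆ (hered M))
                 X₁-avoids-d
                 (iso-minor-transfer {P' ／ ⁅ e ⁆} {pre M ／ ⁅ e ⁆} agree-／e X₁-avoids-d
                    P'─e─d⊆S S⊆E₀─e X₂⊆E₀─e rest-e loops-／)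

  deletable⇒in-M : ∀ {e} → e ∈ E P' → IsMinor N' (P' ＼ ⁅ e ⁆) → e ∈ E₀ ─ X₂
  deletable⇒in-M {e} e∈P' (N'⊆P'─e , _) = ∈─ E₀ X₂ (E₁-other (∈─⁻ˡ E₁ X₂ e∈P') d≢e) (∈─⁻ʳ E₁ X₂ e∈P')
    where
      d≢e : d ≢ e
      d≢e d≡e = ∈─⁻ʳ (E P') ⁅ e ⁆ (N'⊆P'─e d (∈∪ʳ X₁ ⁅ d ⁆ (∈⁅⁆ d))) (from (∈⁅⁆⇔ e d) (sym d≡e))

lemma3p1 : (X₁ X₂ : Subset) → Finite X₁ → Finite X₂ → Disjoint X₁ X₂ →
           (M : Matroid) → Fragile (iso X₁ (X₁ ∪ X₂)) (pre M) →
           (F : Subset) → IsClosure M X₂ F →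
           (d : ℕ) → (M' : Matroid) → AddedFreely M M' F d →
           Fragile (iso X₁ (X₁ ∪ ⁅ d ⁆)) (pre M' ＼ X₂)
lemma3p1 X₁ X₂ _ _ disjoint M fragile F F-closure d M' added = N'-minor-P' , not-both
  where
    open FreeAddition X₁ X₂ disjoint M fragile F F-closure d M' added
    open WithoutElement using (minor-＼; minor-／)
    not-both : ¬ (Σ ℕ λ e → e ∈ E P' × IsMinor N' (P' ＼ ⁅ e ⁆) × IsMinor N' (P' ／ ⁅ e ⁆))
    not-both (e , e∈P' , deletion , contraction) =
      let e∈E₀─X₂ = deletable⇒in-M e∈P' deletion
      in proj₂ fragile (e , ∈─⁻ˡ E₀ X₂ e∈E₀─X₂ , minor-＼ e∈E₀─X₂ deletion , minor-／ e∈E₀─X₂ contraction)
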